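{- For every program $P$, the relation $\leq$ is a partial order on the set $\mathrm{Pos}(P)$ of positions of $P$.
   Context: Fix a set $\mathcal A$ of actions. Programs are generated by $P,Q::=A\mid P;Q\mid P^{*}\mid P+Q\mid P\parallel Q$ with $A\in\mathcal A$. Pre-positions are generated by $p,q::=\bot\mid\top\mid p;q\mid p^{(n)}\mid p+q\mid p\parallel q$ with $n\in\mathbb N$. Validity $P\vdash p$ is defined inductively: $P\vdash\bot$ and $P\vdash\top$ for all $P$; if $P\vdash p$ then $P;Q\vdash p;\bot$, $P+Q\vdash p+\bot$, and $P^*\vdash p^{(n)}$ for all $n$; if $Q\vdash q$ then $P;Q\vdash\top;q$ and $P+Q\vdash\bot+q$; if $P\vdash p$ and $Q\vdash q$ then $P\parallel Q\vdash p\parallel q$. $\mathrm{Pos}(P)=\{p: P\vdash p\}$. The relation $\leq$ on positions of $P$ is the smallest reflexive relation such that: $\bot\leq p$; $p\leq\top$; if $p\leq p'$ and $q\leq q'$ then $p;q\leq p';q'$, $p+q\leq p'+q'$ and $p\parallel q\leq p'\parallel q'$; if $p\leq p'$ then $p^{(n)}\leq p'^{(n)}$; and $p^{(m)}\leq p'^{(n)}$ whenever $m<n$. -}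

module Defs where

open import Data.Nat using (ℕ; _<_)
open import Data.Product using (Σ; proj₁)
open import Relation.Binary.PropositionalEquality using (_≡_)
open import Function using (_on_)

data Program (𝒜 : Set) : Set where
  act  : 𝒜 → Program 𝒜
  _⨾_  : Program 𝒜 → Program 𝒜 → Program 𝒜
  _*   : Program 𝒜 → Program 𝒜
  _⊕_  : Program 𝒜 → Program 𝒜 → Program 𝒜
  _∥_  : Program 𝒜 → Program 𝒜 → Program 𝒜

data PrePos : Set where
  ⊥ₚ   : PrePos
  ⊤ₚ   : PrePos
  _⨾ₚ_ : PrePos → PrePos → PrePos
  _^⟨_⟩ : PrePos → ℕ → PrePos
  _⊕ₚ_ : PrePos → PrePos → PrePos
  _∥ₚ_ : PrePos → PrePos → PrePos

data _⊢_ {𝒜 : Set} : Program 𝒜 → PrePos → Set where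
  ⊢⊥   : ∀ {P} → P ⊢ ⊥ₚ
  ⊢⊤   : ∀ {P} → P ⊢ ⊤ₚ
  ⊢⨾ˡ  : ∀ {P Q p} → P ⊢ p → (P ⨾ Q) ⊢ (p ⨾ₚ ⊥ₚ)
  ⊢⊕ˡ  : ∀ {P Q p} → P ⊢ p → (P ⊕ Q) ⊢ (p ⊕ₚ ⊥ₚ)
  ⊢*   : ∀ {P p} (n : ℕ) → P ⊢ p → (P *) ⊢ (p ^⟨ n ⟩)
  ⊢⨾ʳ  : ∀ {P Q q} → Q ⊢ q → (P ⨾ Q) ⊢ (⊤ₚ ⨾ₚ q)
  ⊢⊕ʳ  : ∀ {P Q q} → Q ⊢ q → (P ⊕ Q) ⊢ (⊥ₚ ⊕ₚ q)
  ⊢∥   : ∀ {P Q p q} → P ⊢ p → Q ⊢ q → (P ∥ Q) ⊢ (p ∥ₚ q)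

Pos : {𝒜 : Set} → Program 𝒜 → Set
Pos P = Σ PrePos (P ⊢_)

-- The relation ≤ : smallest reflexive relation closed under the given rules
-- (no transitivity rule).
data _≤ₚ_ : PrePos → PrePos → Set where
  ≤-refl : ∀ {p} → p ≤ₚ p
  ⊥≤     : ∀ {p} → ⊥ₚ ≤ₚ p
  ≤⊤     : ∀ {p} → p ≤ₚ ⊤ₚ
  ≤⨾     : ∀ {p p' q q'} → p ≤ₚ p' → q ≤ₚ q' → (p ⨾ₚ q) ≤ₚ (p' ⨾ₚ q')
  ≤⊕     : ∀ {p p' q q'} → p ≤ₚ p' → q ≤ₚ q' → (p ⊕ₚ q) ≤ₚ (p' ⊕ₚ q')
  ≤∥     : ∀ {p p' q q'} → p ≤ₚ p' → q ≤ₚ q' → (p ∥ₚ q) ≤ₚ (p' ∥ₚ q')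
  ≤^     : ∀ {p p' n} → p ≤ₚ p' → (p ^⟨ n ⟩) ≤ₚ (p' ^⟨ n ⟩)
  ≤^<    : ∀ {p p' m n} → m < n → (p ^⟨ m ⟩) ≤ₚ (p' ^⟨ n ⟩)

_≈Pos_ : {𝒜 : Set} {P : Program 𝒜} → Pos P → Pos P → Set
_≈Pos_ = _≡_ on proj₁

_≤Pos_ : {𝒜 : Set} {P : Program 𝒜} → Pos P → Pos P → Set
_≤Pos_ = _≤ₚ_ on proj₁

{-# OPTIONS --safe #-}
-- ≤ is a partial order on all pre-positions, and on Pos P it is the pullback
-- along the first projection. Although ≤ is not closed under transitivity by
-- definition, every composite of two rules is again an instance of a rule;
-- antisymmetry holds componentwise, except for p^(m) ≤ q^(n) ≤ p^(m), which
-- forces m = n.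
module Submission where

open import Defs
open import Relation.Binary.Structures using (IsPreorder; IsPartialOrder)
open import Relation.Binary.Definitions using (Transitive; Antisymmetric)
open import Relation.Binary.PropositionalEquality using (_≡_; refl; cong; cong₂)
import Relation.Binary.PropositionalEquality.Properties as ≡
import Relation.Binary.Construct.On as On
open import Data.Nat.Properties using (<-trans; <-irrefl; <-asym)
open import Data.Product using (proj₁)
open import Data.Empty using (⊥-elim)

≤ₚ-trans : Transitive _≤ₚ_
≤ₚ-trans ≤-refl      q≤r         = q≤r
≤ₚ-trans ⊥≤          _           = ⊥≤
≤ₚ-trans p≤q         ≤-refl      = p≤q
≤ₚ-trans _           ≤⊤          = ≤⊤
≤ₚ-trans (≤⨾ a b)    (≤⨾ c d)    = ≤⨾ (≤ₚ-trans a c) (≤ₚ-trans b d)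
≤ₚ-trans (≤⊕ a b)    (≤⊕ c d)    = ≤⊕ (≤ₚ-trans a c) (≤ₚ-trans b d)
≤ₚ-trans (≤∥ a b)    (≤∥ c d)    = ≤∥ (≤ₚ-trans a c) (≤ₚ-trans b d)
≤ₚ-trans (≤^ a)      (≤^ b)      = ≤^ (≤ₚ-trans a b)
≤ₚ-trans (≤^ _)      (≤^< n<k)   = ≤^< n<k
≤ₚ-trans (≤^< m<n)   (≤^ _)      = ≤^< m<n
≤ₚ-trans (≤^< m<n)   (≤^< n<k)   = ≤^< (<-trans m<n n<k)

≤ₚ-antisym : Antisymmetric _≡_ _≤ₚ_
≤ₚ-antisym ≤-refl    _           = refl
≤ₚ-antisym _         ≤-refl      = refl
≤ₚ-antisym ⊥≤        ⊥≤          = refl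
≤ₚ-antisym ≤⊤        ≤⊤          = refl
≤ₚ-antisym (≤⨾ a b)  (≤⨾ c d)    = cong₂ _⨾ₚ_ (≤ₚ-antisym a c) (≤ₚ-antisym b d)
≤ₚ-antisym (≤⊕ a b)  (≤⊕ c d)    = cong₂ _⊕ₚ_ (≤ₚ-antisym a c) (≤ₚ-antisym b d)
≤ₚ-antisym (≤∥ a b)  (≤∥ c d)    = cong₂ _∥ₚ_ (≤ₚ-antisym a c) (≤ₚ-antisym b d)
≤ₚ-antisym (≤^ a)    (≤^ b)      = cong (_^⟨ _ ⟩) (≤ₚ-antisym a b)
≤ₚ-antisym (≤^ _)    (≤^< n<n)   = ⊥-elim (<-irrefl refl n<n)
≤ₚ-antisym (≤^< n<n) (≤^ _)      = ⊥-elim (<-irrefl refl n<n)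
≤ₚ-antisym (≤^< m<n) (≤^< n<m)   = ⊥-elim (<-asym m<n n<m)

≤ₚ-isPreorder : IsPreorder _≡_ _≤ₚ_
≤ₚ-isPreorder = record
  { isEquivalence = ≡.isEquivalence
  ; reflexive     = λ { refl → ≤-refl }
  ; trans         = ≤ₚ-trans
  }

≤ₚ-isPartialOrder : IsPartialOrder _≡_ _≤ₚ_
≤ₚ-isPartialOrder = record
  { isPreorder = ≤ₚ-isPreorder
  ; antisym    = ≤ₚ-antisym
  }

proposition2p9 : (𝒜 : Set) (P : Program 𝒜) → IsPartialOrder (_≈Pos_ {𝒜} {P}) (_≤Pos_ {𝒜} {P})
proposition2p9 𝒜 P = On.isPartialOrder proj₁ ≤ₚ-isPartialOrder
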